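{- The order and the independence number, with their canonical hyperparameterisations, are awesome graph parameters.
   Context: All graphs are finite, simple and undirected; $\alpha,\omega$ denote independence and clique number. A graph class is a set of graphs closed under isomorphism. A hypergraph over $G$ is a nonempty set of subsets of $V(G)$; a hypermapping $\mathcal F$ assigns to each graph $G$ a finite nonempty family $\mathcal F_G$ of hypergraphs over $G$, compatibly with isomorphisms. A basic hyperparameter is a pair $(\mathrm{opt},\mathcal F)$ with $\mathrm{opt}\in\{\mathrm{minmax},\mathrm{maxmin}\}$, with value $\rho(G)=\min_{H\in\mathcal F_G}\max_{X\in H}|X|$ (minmax) or $\max_{H\in\mathcal F_G}\min_{X\in H}|X|$ (maxmin); its independence variant $\alpha\text{ - }\rho$ is defined by the same formulas with $|X|$ replaced by $\alpha(G[X])$. The canonical hyperparameterisation of the order is $\mathcal F_G=\{\{V(G)\}\}$ (with either choice of $\mathrm{opt}$); that of the independence number is $\mathrm{opt}=\mathrm{minmax}$, $\mathcal F_G=\{\{X: X \text{ independent in } G\}\}$. A class $\mathcal G$ has bounded $\sigma$ if there is an integer $c$ with $\sigma(G')\le c$ for every induced subgraph $G'$ of every $G\in\mathcal G$; it has clique-bounded $\sigma$ if there is a nondecreasing $f$ with $\sigma(G')\le f(\omega(G'))$ for all such $G'$. A basic hyperparameter $\rho$ is awesome if, for every graph class, clique-bounded $\rho$ is equivalent to bounded $\alpha\text{ - }\rho$. -}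

module Defs where

open import Data.Nat using (ℕ; zero; suc; _≤_; _⊔_; _⊓_)
open import Data.Bool using (Bool; true; false; not; _∧_; if_then_else_)
open import Data.Fin using (Fin)
open import Data.Fin.Subset using (Subset; ∣_∣; ⊥; ⊤; _⊆_)
open import Data.Vec using (Vec; []; _∷_; lookup)
open import Data.List using (List; []; _∷_; map; concatMap; filter; allFin; foldr; _++_)
open import Data.List.NonEmpty using (List⁺; _∷_; [_]; foldr₁)
import Data.List.NonEmpty as L⁺
open import Data.Product using (Σ; ∃; _×_; _,_)
open import Relation.Binary.PropositionalEquality using (_≡_)
open import Function.Bundles using (_↔_; Inverse; _⇔_)
open import Function.Definitions using (Injective)
open import Function using (_∘_)
open import Data.Bool using (T)
open import Data.Bool.ListAction using (and)

record Graph : Set where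
  field
    n      : ℕ
    adj    : Fin n → Fin n → Bool
    sym    : ∀ i j → adj i j ≡ adj j i
    irrefl : ∀ i → adj i i ≡ false
open Graph public

record _≅_ (G H : Graph) : Set where
  field
    bij  : Fin (n G) ↔ Fin (n H)
    pres : ∀ i j → adj G i j ≡ adj H (Inverse.to bij i) (Inverse.to bij j)

record _≤ᵢ_ (G' G : Graph) : Set where
  field
    emb  : Fin (n G') → Fin (n G)
    inj  : Injective _≡_ _≡_ emb
    pres : ∀ i j → adj G' i j ≡ adj G (emb i) (emb j)

record GraphClass : Set₁ where
  field
    member : Graph → Set
    closed : ∀ {G H} → G ≅ H → member G → member H
open GraphClass public

allSubsets : (k : ℕ) → List (Subset k)
allSubsets zero    = [] ∷ []
allSubsets (suc k) = map (false ∷_) (allSubsets k) ++ map (true ∷_) (allSubsets k)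

maxL : List ℕ → ℕ
maxL = foldr _⊔_ 0

max⁺ : List⁺ ℕ → ℕ
max⁺ = foldr₁ _⊔_

min⁺ : List⁺ ℕ → ℕ
min⁺ = foldr₁ _⊓_

allPairs : {k : ℕ} → (Fin k → Fin k → Bool) → Bool
allPairs {k} p = and (concatMap (λ i → map (λ j → p i j) (allFin k)) (allFin k))

allVerts : {k : ℕ} → (Fin k → Bool) → Bool
allVerts {k} p = and (map p (allFin k))

isIndependent : (G : Graph) → Subset (n G) → Bool
isIndependent G Y = allPairs (λ i j → not (lookup Y i ∧ lookup Y j ∧ adj G i j))

isClique : (G : Graph) → Subset (n G) → Bool
isClique G Y = allPairs (λ i j → not (lookup Y i ∧ lookup Y j ∧ not (adj G i j))
                                 ∨' eqFin i j)
  where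
  open import Data.Fin using (_≟_)
  open import Relation.Nullary.Decidable using (⌊_⌋)
  _∨'_ : Bool → Bool → Bool
  true ∨' _ = true
  false ∨' b = b
  eqFin : Fin (n G) → Fin (n G) → Bool
  eqFin i j = ⌊ i ≟ j ⌋

subsetOf : {k : ℕ} → Subset k → Subset k → Bool
subsetOf Y X = allVerts (λ i → not (lookup Y i) ∨ lookup X i)
  where open import Data.Bool using (_∨_)

-- α(G[X]): largest independent set of G contained in X
αOn : (G : Graph) → Subset (n G) → ℕ
αOn G X = maxL (map ∣_∣ (filter (λ Y → T? (subsetOf Y X ∧ isIndependent G Y)) (allSubsets (n G))))
  where open import Data.Bool using (T?)

α : Graph → ℕ
α G = αOn G ⊤

ω : Graph → ℕ
ω G = maxL (map ∣_∣ (filter (λ Y → T? (isClique G Y)) (allSubsets (n G))))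
  where open import Data.Bool using (T?)

Hypergraph : Graph → Set
Hypergraph G = List⁺ (Subset (n G))

Hypermapping : Set
Hypermapping = (G : Graph) → List⁺ (Hypergraph G)

data Opt : Set where
  minmax maxmin : Opt

record BasicHyperparameter : Set where
  constructor ⟨_,_⟩
  field
    opt : Opt
    fam : Hypermapping

-- evaluate with a weight w on vertex sets (|X| or α(G[X]))
evalWith : Opt → (G : Graph) → List⁺ (Hypergraph G) → (Subset (n G) → ℕ) → ℕ
evalWith minmax G F w = min⁺ (L⁺.map (λ H → max⁺ (L⁺.map w H)) F)
evalWith maxmin G F w = max⁺ (L⁺.map (λ H → min⁺ (L⁺.map w H)) F)

value : BasicHyperparameter → Graph → ℕ
value ⟨ o , F ⟩ G = evalWith o G (F G) ∣_∣

αvalue : BasicHyperparameter → Graph → ℕ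
αvalue ⟨ o , F ⟩ G = evalWith o G (F G) (αOn G)

Bounded : GraphClass → (Graph → ℕ) → Set
Bounded 𝒢 σ = ∃ λ (c : ℕ) → ∀ G → member 𝒢 G → ∀ G' → G' ≤ᵢ G → σ G' ≤ c

Nondecreasing : (ℕ → ℕ) → Set
Nondecreasing f = ∀ {a b} → a ≤ b → f a ≤ f b

CliqueBounded : GraphClass → (Graph → ℕ) → Set
CliqueBounded 𝒢 σ = ∃ λ (f : ℕ → ℕ) → Nondecreasing f ×
  (∀ G → member 𝒢 G → ∀ G' → G' ≤ᵢ G → σ G' ≤ f (ω G'))

Awesome : BasicHyperparameter → Set₁
Awesome ρ = ∀ (𝒢 : GraphClass) → CliqueBounded 𝒢 (value ρ) ⇔ Bounded 𝒢 (αvalue ρ)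

orderHP : Opt → BasicHyperparameter
orderHP o = ⟨ o , (λ G → [ [ ⊤ ] ]) ⟩

-- independence number: minmax, F_G = {{X : X independent in G}}
-- (the empty set is listed first; it is independent, so this is exactly
--  the set of independent sets, written as a nonempty list)
independentSets : (G : Graph) → Hypergraph G
independentSets G = ⊥ ∷ filter (λ Y → T? (isIndependent G Y)) (allSubsets (n G))
  where open import Data.Bool using (T?)

independenceHP : BasicHyperparameter
independenceHP = ⟨ minmax , (λ G → [ independentSets G ]) ⟩

-- For the order: if n ≤ f(ω) on induced subgraphs, then in particular a maximum
-- independent set, which induces an edgeless graph of clique number at most 1, has
-- size at most f(1); so α is bounded. Conversely, if α ≤ c on induced subgraphs, the
-- Erdős–Szekeres argument gives n < 2^(ω + α) ≤ 2^(ω + c), a nondecreasing bound in ω.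
-- For the independence number both the value and its α-variant equal α, and the same
-- two arguments apply because α ≤ n.

module Submission where

open import Defs hiding (sym)
open import Data.Bool using (Bool; true; false; not; _∧_; _∨_; T; T?)
open import Data.Bool.Properties using (T-∧)
open import Data.Bool.ListAction using (and)
open import Data.Empty using (⊥-elim)
open import Data.Fin using (Fin; zero; suc; _≟_)
open import Data.Fin.Properties using (suc-injective)
open import Data.Fin.Subset using (Subset; ∣_∣; ⊥; ⊤; _∈_; _∉_; _⊆_; ⁅_⁆; _∪_; _∩_; ∁)
open import Data.Fin.Subset.Properties
  using ( _∈?_; nonempty?; Empty-unique; ∉⊥; ⊥⊆; ⊆⊤; ⊆-refl; x∈⁅x⁆; x∈⁅y⁆⇒x≡y
        ; x∈p∪q⁺; x∈p∪q⁻; x∈p∩q⁺; x∈p∩q⁻; p∩q⊆p; x∈∁p⇒x∉p; x∉p⇒x∈∁p; ∪-identityˡ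
        ; ∣⊥∣≡0; ∣⊤∣≡n; ∣⁅x⁆∣≡1; ∣p∣≤n; ∣p∣≤∣x∷p∣; p⊆q⇒∣p∣≤∣q∣ )
open import Data.List using ([]; _∷_; map; filter; allFin)
import Data.List.Membership.Propositional as List
open import Data.List.Membership.Propositional.Properties
  using (∈-map⁺; ∈-map⁻; ∈-filter⁺; ∈-filter⁻; ∈-++⁺ˡ; ∈-++⁺ʳ; ∈-concatMap⁺; ∈-concatMap⁻; ∈-allFin)
import Data.List.Relation.Unary.Any as Any
import Data.List.NonEmpty as List⁺
open import Data.Nat using (ℕ; zero; suc; _≤_; _<_; _⊔_; _+_; _^_; z≤n; s≤s)
open import Data.Nat.Properties
  using ( ≤-refl; ≤-reflexive; ≤-trans; ≤-antisym; ≤-pred; <⇒≤; module ≤-Reasoning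
        ; m≤m⊔n; m≤n⊔m; ⊔-lub; ⊔-sel; ⊔-identityʳ; +-suc; +-identityʳ
        ; +-mono-≤; +-monoˡ-≤; +-monoʳ-≤; m^n>0; ^-monoʳ-≤ )
open import Data.Product using (∃; _×_; _,_; proj₁; proj₂)
open import Data.Sum using (_⊎_; inj₁; inj₂)
open import Data.Vec using ([]; _∷_; lookup; tabulate; here; there)
open import Data.Vec.Properties using ([]=↔lookup; lookup∘tabulate)
open import Function using (_∘_; _$_)
open import Function.Bundles using (Equivalence; _⇔_; mk⇔; Inverse)
open import Function.Definitions using (Injective)
open import Relation.Binary.PropositionalEquality
open import Relation.Nullary using (yes; no)
open import Relation.Unary using (Decidable)

open Equivalence using (to; from)

maxL-upper : ∀ {x xs} → x List.∈ xs → x ≤ maxL xs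
maxL-upper {xs = y ∷ ys} (Any.here refl) = m≤m⊔n y (maxL ys)
maxL-upper {xs = y ∷ ys} (Any.there p)   = ≤-trans (maxL-upper p) (m≤n⊔m y (maxL ys))

maxL-least : ∀ {c} xs → (∀ {x} → x List.∈ xs → x ≤ c) → maxL xs ≤ c
maxL-least []       h = z≤n
maxL-least (y ∷ ys) h = ⊔-lub (h (Any.here refl)) (maxL-least ys (h ∘ Any.there))

maxL-attained : ∀ xs → maxL xs ≡ 0 ⊎ maxL xs List.∈ xs
maxL-attained []       = inj₁ refl
maxL-attained (y ∷ ys) with ⊔-sel y (maxL ys) | maxL-attained ys
... | inj₁ eq | _       = inj₂ (Any.here eq)
... | inj₂ eq | inj₁ z  = inj₁ (trans eq z)
... | inj₂ eq | inj₂ m  = inj₂ (subst (List._∈ y ∷ ys) (sym eq) (Any.there m))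

max⁺-map : ∀ {A : Set} (f : A → ℕ) xs → max⁺ (List⁺.map f xs) ≡ maxL (map f (List⁺.toList xs))
max⁺-map f (x List⁺.∷ xs) = go x xs
  where
  go : ∀ x xs → max⁺ (List⁺.map f (x List⁺.∷ xs)) ≡ maxL (map f (x ∷ xs))
  go x []       = sym (⊔-identityʳ (f x))
  go x (y ∷ ys) = cong (f x ⊔_) (go y ys)

T-and⁺ : ∀ xs → (∀ {x} → x List.∈ xs → T x) → T (and xs)
T-and⁺ []       h = _
T-and⁺ (x ∷ xs) h = from T-∧ (h (Any.here refl) , T-and⁺ xs (h ∘ Any.there))

T-and⁻ : ∀ {x} xs → T (and xs) → x List.∈ xs → T x
T-and⁻ (y ∷ ys) t (Any.here refl) = proj₁ (to T-∧ t)
T-and⁻ (y ∷ ys) t (Any.there m)   = T-and⁻ ys (proj₂ (to T-∧ t)) m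

T-allPairs⁺ : ∀ {k} (p : Fin k → Fin k → Bool) → (∀ i j → T (p i j)) → T (allPairs p)
T-allPairs⁺ {k} p h = T-and⁺ _ λ m →
  let i , m′ = Any.satisfied (∈-concatMap⁻ (λ i → map (p i) (allFin k)) {xs = allFin k} m)
      j , _ , eq = ∈-map⁻ (p i) m′
  in subst T (sym eq) (h i j)

T-allPairs⁻ : ∀ {k} (p : Fin k → Fin k → Bool) → T (allPairs p) → ∀ i j → T (p i j)
T-allPairs⁻ {k} p t i j = T-and⁻ _ t
  (∈-concatMap⁺ (λ i → map (p i) (allFin k)) (List.lose (∈-allFin i) (∈-map⁺ (p i) (∈-allFin j))))

T-allVerts⁺ : ∀ {k} (p : Fin k → Bool) → (∀ i → T (p i)) → T (allVerts p)
T-allVerts⁺ {k} p h = T-and⁺ (map p (allFin k)) λ m → let i , _ , eq = ∈-map⁻ p m in subst T (sym eq) (h i)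

∈-allSubsets : ∀ {k} (Y : Subset k) → Y List.∈ allSubsets k
∈-allSubsets []                  = Any.here refl
∈-allSubsets {suc k} (false ∷ Y) = ∈-++⁺ˡ (∈-map⁺ (false ∷_) (∈-allSubsets Y))
∈-allSubsets {suc k} (true ∷ Y)  = ∈-++⁺ʳ (map (false ∷_) (allSubsets k)) (∈-map⁺ (true ∷_) (∈-allSubsets Y))

∈⇒lookup : ∀ {k} {Y : Subset k} {i} → i ∈ Y → lookup Y i ≡ true
∈⇒lookup = Inverse.to []=↔lookup

lookup⇒∈ : ∀ {k} {Y : Subset k} {i} → lookup Y i ≡ true → i ∈ Y
lookup⇒∈ = Inverse.from []=↔lookup

Independent : (G : Graph) → Subset (n G) → Set
Independent G Y = ∀ {i j} → i ∈ Y → j ∈ Y → adj G i j ≡ false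

Clique : (G : Graph) → Subset (n G) → Set
Clique G Y = ∀ {i j} → i ∈ Y → j ∈ Y → i ≢ j → adj G i j ≡ true

T-not-∧∧⁺ : ∀ {a b c} → (a ≡ true → b ≡ true → c ≡ false) → T (not (a ∧ b ∧ c))
T-not-∧∧⁺ {false}        h = _
T-not-∧∧⁺ {true} {false} h = _
T-not-∧∧⁺ {true} {true}  h rewrite h refl refl = _

T-not-∧∧⁻ : ∀ {a b c} → T (not (a ∧ b ∧ c)) → a ≡ true → b ≡ true → c ≡ false
T-not-∧∧⁻ {true} {true} {false} _ refl refl = refl

independent⇒isIndependent : ∀ G {Y} → Independent G Y → T (isIndependent G Y)
independent⇒isIndependent G ind =
  T-allPairs⁺ {n G} _ λ i j → T-not-∧∧⁺ λ i∈Y j∈Y → ind (lookup⇒∈ i∈Y) (lookup⇒∈ j∈Y)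

isIndependent⇒independent : ∀ G {Y} → T (isIndependent G Y) → Independent G Y
isIndependent⇒independent G t {i} {j} i∈Y j∈Y =
  T-not-∧∧⁻ (T-allPairs⁻ {n G} _ t i j) (∈⇒lookup i∈Y) (∈⇒lookup j∈Y)

clique⇒isClique : ∀ G {Y} → Clique G Y → T (isClique G Y)
clique⇒isClique G {Y} clq = T-allPairs⁺ cliqueTest pair
  where
  -- The pair test of isClique uses an operator private to Defs; unification
  -- against isClique names it.
  cliqueTest : Fin (n G) → Fin (n G) → Bool
  cliqueTest = _
  _ : allPairs cliqueTest ≡ isClique G Y
  _ = refl
  pair : ∀ i j → T (cliqueTest i j)
  pair i j with lookup Y i in i∈Y | lookup Y j in j∈Y | i ≟ j | adj G i j in ij
  ... | false | _     | _     | _     = _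
  ... | true  | false | _     | _     = _
  ... | true  | true  | yes _ | true  = _
  ... | true  | true  | yes _ | false = _
  ... | true  | true  | no  _ | true  = _
  ... | true  | true  | no i≢j | false
    with () ← trans (sym ij) (clq (lookup⇒∈ i∈Y) (lookup⇒∈ j∈Y) i≢j)

isClique⇒clique : ∀ G {Y} → T (isClique G Y) → Clique G Y
isClique⇒clique G {Y} t {i} {j} i∈Y j∈Y i≢j with T-allPairs⁻ {n G} _ t i j
... | pair rewrite ∈⇒lookup i∈Y | ∈⇒lookup j∈Y with i ≟ j | adj G i j
...   | yes i≡j | _    = ⊥-elim (i≢j i≡j)
...   | no _    | true = refl

⊆⇒subsetOf : ∀ {k} {Y X : Subset k} → Y ⊆ X → T (subsetOf Y X)
⊆⇒subsetOf {Y = Y} {X} Y⊆X = T-allVerts⁺ _ pointwise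
  where
  pointwise : ∀ i → T (not (lookup Y i) ∨ lookup X i)
  pointwise i with lookup Y i in i∈Y
  ... | false = _
  ... | true rewrite ∈⇒lookup (Y⊆X (lookup⇒∈ i∈Y)) = _

independent-⊥ : ∀ G → Independent G ⊥
independent-⊥ G i∈⊥ = ⊥-elim (∉⊥ i∈⊥)

clique-⊥ : ∀ G → Clique G ⊥
clique-⊥ G i∈⊥ = ⊥-elim (∉⊥ i∈⊥)

module _ {k : ℕ} {P : Subset k → Set} (P? : Decidable P) where

  maxSize : ℕ
  maxSize = maxL (map ∣_∣ (filter P? (allSubsets k)))

  ∣∣≤maxSize : ∀ {Y} → P Y → ∣ Y ∣ ≤ maxSize
  ∣∣≤maxSize {Y} PY = maxL-upper (∈-map⁺ ∣_∣ (∈-filter⁺ P? {xs = allSubsets k} (∈-allSubsets Y) PY))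

  maxSize-attained : P ⊥ → ∃ λ Y → P Y × maxSize ≡ ∣ Y ∣
  maxSize-attained P⊥ with maxL-attained (map ∣_∣ (filter P? (allSubsets k)))
  ... | inj₁ ≡0 = ⊥ , P⊥ , trans ≡0 (sym (∣⊥∣≡0 k))
  ... | inj₂ ∈sizes with ∈-map⁻ ∣_∣ {xs = filter P? (allSubsets k)} ∈sizes
  ...   | Y , Y∈ , eq = Y , proj₂ (∈-filter⁻ P? {xs = allSubsets k} Y∈) , eq

independent⇒≤αOn : ∀ G {X Y} → Independent G Y → Y ⊆ X → ∣ Y ∣ ≤ αOn G X
independent⇒≤αOn G {X} {Y} ind Y⊆X =
  ∣∣≤maxSize (λ Z → T? (subsetOf Z X ∧ isIndependent G Z)) {Y} (from T-∧ (⊆⇒subsetOf Y⊆X , independent⇒isIndependent G ind))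

αOn-attained : ∀ G X → ∃ λ Y → Independent G Y × αOn G X ≡ ∣ Y ∣
αOn-attained G X with maxSize-attained (λ Y → T? (subsetOf Y X ∧ isIndependent G Y))
                        (from T-∧ (⊆⇒subsetOf {Y = ⊥} {X} ⊥⊆ , independent⇒isIndependent G (independent-⊥ G)))
... | Y , t , eq = Y , isIndependent⇒independent G (proj₂ (to T-∧ t)) , eq

clique⇒≤ω : ∀ G {Y} → Clique G Y → ∣ Y ∣ ≤ ω G
clique⇒≤ω G {Y} clq = ∣∣≤maxSize (λ Z → T? (isClique G Z)) {Y} (clique⇒isClique G clq)

ω-attained : ∀ G → ∃ λ Y → Clique G Y × ω G ≡ ∣ Y ∣
ω-attained G with maxSize-attained (λ Y → T? (isClique G Y)) (clique⇒isClique G (clique-⊥ G))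
... | Y , t , eq = Y , isClique⇒clique G t , eq

αOn≤α : ∀ G X → αOn G X ≤ α G
αOn≤α G X with αOn-attained G X
... | Y , ind , eq = ≤-trans (≤-reflexive eq) (independent⇒≤αOn G ind ⊆⊤)

α≤n : ∀ G → α G ≤ n G
α≤n G with αOn-attained G ⊤
... | Y , _ , eq = ≤-trans (≤-reflexive eq) (∣p∣≤n Y)

enum : ∀ {k} (Y : Subset k) → Fin ∣ Y ∣ → Fin k
enum (true ∷ Y)  zero    = zero
enum (true ∷ Y)  (suc i) = suc (enum Y i)
enum (false ∷ Y) i       = suc (enum Y i)

enum-∈ : ∀ {k} (Y : Subset k) i → enum Y i ∈ Y
enum-∈ (true ∷ Y)  zero    = here
enum-∈ (true ∷ Y)  (suc i) = there (enum-∈ Y i)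
enum-∈ (false ∷ Y) i       = there (enum-∈ Y i)

enum-injective : ∀ {k} (Y : Subset k) → Injective _≡_ _≡_ (enum Y)
enum-injective (true ∷ Y)  {zero}  {zero}  _  = refl
enum-injective (true ∷ Y)  {suc i} {suc j} eq = cong suc (enum-injective Y (suc-injective eq))
enum-injective (false ∷ Y)                 eq = enum-injective Y (suc-injective eq)

induced : (G : Graph) → Subset (n G) → Graph
induced G Y = record
  { n      = ∣ Y ∣
  ; adj    = λ i j → adj G (enum Y i) (enum Y j)
  ; sym    = λ i j → Graph.sym G (enum Y i) (enum Y j)
  ; irrefl = λ i → irrefl G (enum Y i)
  }

induced-≤ᵢ : ∀ G Y → induced G Y ≤ᵢ G
induced-≤ᵢ G Y = record { emb = enum Y ; inj = enum-injective Y ; pres = λ _ _ → refl }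

≤ᵢ-trans : ∀ {A B C} → A ≤ᵢ B → B ≤ᵢ C → A ≤ᵢ C
≤ᵢ-trans A≤B B≤C = record
  { emb  = B≤C.emb ∘ A≤B.emb
  ; inj  = A≤B.inj ∘ B≤C.inj
  ; pres = λ i j → trans (A≤B.pres i j) (B≤C.pres (A≤B.emb i) (A≤B.emb j))
  }
  where
  module A≤B = _≤ᵢ_ A≤B
  module B≤C = _≤ᵢ_ B≤C

Edgeless : Graph → Set
Edgeless H = ∀ i j → adj H i j ≡ false

independent⇒induced-edgeless : ∀ G {Y} → Independent G Y → Edgeless (induced G Y)
independent⇒induced-edgeless G {Y} ind i j = ind (enum-∈ Y i) (enum-∈ Y j)

∣p∣≤1 : ∀ {k} (p : Subset k) → (∀ {i j} → i ∈ p → j ∈ p → i ≡ j) → ∣ p ∣ ≤ 1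
∣p∣≤1 {k} p all-equal with nonempty? p
... | yes (i , i∈p) = subst (∣ p ∣ ≤_) (∣⁅x⁆∣≡1 i)
                        (p⊆q⇒∣p∣≤∣q∣ λ j∈p → subst (_∈ ⁅ i ⁆) (all-equal i∈p j∈p) (x∈⁅x⁆ i))
... | no empty      = subst (_≤ 1) (sym (trans (cong ∣_∣ (Empty-unique empty)) (∣⊥∣≡0 k))) z≤n

edgeless⇒ω≤1 : ∀ H → Edgeless H → ω H ≤ 1
edgeless⇒ω≤1 H edgeless with ω-attained H
... | Y , clq , eq = ≤-trans (≤-reflexive eq) (∣p∣≤1 Y all-equal)
  where
  all-equal : ∀ {i j} → i ∈ Y → j ∈ Y → i ≡ j
  all-equal {i} {j} i∈Y j∈Y with i ≟ j
  ... | yes i≡j = i≡j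
  ... | no i≢j with () ← trans (sym (clq i∈Y j∈Y i≢j)) (edgeless i j)

edgeless⇒n≤α : ∀ H → Edgeless H → n H ≤ α H
edgeless⇒n≤α H edgeless =
  subst (_≤ α H) (∣⊤∣≡n (n H)) (independent⇒≤αOn H {⊤} {⊤} (λ {i} {j} _ _ → edgeless i j) ⊆⊤)

α≤f[1] : ∀ {f} → Nondecreasing f → ∀ G → (∀ G' → G' ≤ᵢ G → α G' ≤ f (ω G')) → α G ≤ f 1
α≤f[1] {f} mono G bound with αOn-attained G ⊤
... | Y , ind , eq = begin
  α G      ≡⟨ eq ⟩
  n H      ≤⟨ edgeless⇒n≤α H edgeless ⟩
  α H      ≤⟨ bound H (induced-≤ᵢ G Y) ⟩
  f (ω H)  ≤⟨ mono (edgeless⇒ω≤1 H edgeless) ⟩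
  f 1      ∎
  where
  open ≤-Reasoning
  H = induced G Y
  edgeless = independent⇒induced-edgeless G ind

∣p∪q∣≤∣p∣+∣q∣ : ∀ {k} (p q : Subset k) → ∣ p ∪ q ∣ ≤ ∣ p ∣ + ∣ q ∣
∣p∪q∣≤∣p∣+∣q∣ []          []          = z≤n
∣p∪q∣≤∣p∣+∣q∣ (true ∷ p)  (y ∷ q)     =
  s≤s (≤-trans (∣p∪q∣≤∣p∣+∣q∣ p q) (+-monoʳ-≤ ∣ p ∣ (∣p∣≤∣x∷p∣ y q)))
∣p∪q∣≤∣p∣+∣q∣ (false ∷ p) (true ∷ q)  =
  subst (suc ∣ p ∪ q ∣ ≤_) (sym (+-suc ∣ p ∣ ∣ q ∣)) (s≤s (∣p∪q∣≤∣p∣+∣q∣ p q))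
∣p∪q∣≤∣p∣+∣q∣ (false ∷ p) (false ∷ q) = ∣p∪q∣≤∣p∣+∣q∣ p q

∣⁅x⁆∪p∣≡1+∣p∣ : ∀ {k} x (p : Subset k) → x ∉ p → ∣ ⁅ x ⁆ ∪ p ∣ ≡ suc ∣ p ∣
∣⁅x⁆∪p∣≡1+∣p∣ zero    (false ∷ p) _   = cong (suc ∘ ∣_∣) (∪-identityˡ p)
∣⁅x⁆∪p∣≡1+∣p∣ zero    (true ∷ p)  x∉p = ⊥-elim (x∉p here)
∣⁅x⁆∪p∣≡1+∣p∣ (suc x) (false ∷ p) x∉p = ∣⁅x⁆∪p∣≡1+∣p∣ x p (x∉p ∘ there)
∣⁅x⁆∪p∣≡1+∣p∣ (suc x) (true ∷ p)  x∉p = cong suc (∣⁅x⁆∪p∣≡1+∣p∣ x p (x∉p ∘ there))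

⁅x⁆∪p⊆q : ∀ {k} {x} {p q : Subset k} → x ∈ q → p ⊆ q → ⁅ x ⁆ ∪ p ⊆ q
⁅x⁆∪p⊆q {x = x} {p} x∈q p⊆q y∈ with x∈p∪q⁻ ⁅ x ⁆ p y∈
... | inj₁ y∈⁅x⁆ = subst (_∈ _) (sym (x∈⁅y⁆⇒x≡y x y∈⁅x⁆)) x∈q
... | inj₂ y∈p   = p⊆q y∈p

2^-step : ∀ a b → 2 ^ (a + suc b) + 2 ^ (suc a + b) ≡ 2 ^ (suc a + suc b)
2^-step a b = begin
  2 ^ (a + suc b) + 2 ^ suc (a + b)   ≡⟨ cong (λ e → 2 ^ e + 2 ^ suc (a + b)) (+-suc a b) ⟩
  2 ^ suc (a + b) + 2 ^ suc (a + b)   ≡⟨ cong (2 ^ suc (a + b) +_) (sym (+-identityʳ _)) ⟩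
  2 ^ suc (suc (a + b))               ≡⟨ cong (λ e → 2 ^ suc e) (sym (+-suc a b)) ⟩
  2 ^ (suc a + suc b)                 ∎
  where open ≡-Reasoning

module _ (G : Graph) where

  CliquesAtMost : ℕ → Subset (n G) → Set
  CliquesAtMost a S = ∀ {Y} → Y ⊆ S → Clique G Y → ∣ Y ∣ ≤ a

  IndependentsAtMost : ℕ → Subset (n G) → Set
  IndependentsAtMost b S = ∀ {Y} → Y ⊆ S → Independent G Y → ∣ Y ∣ ≤ b

  neighbours : Fin (n G) → Subset (n G)
  neighbours v = tabulate (adj G v)

  ∈-neighbours⁻ : ∀ {v j} → j ∈ neighbours v → adj G v j ≡ true
  ∈-neighbours⁻ {v} {j} j∈ = trans (sym (lookup∘tabulate (adj G v) j)) (∈⇒lookup j∈)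

  ∉-neighbours⁻ : ∀ {v j} → j ∉ neighbours v → adj G v j ≡ false
  ∉-neighbours⁻ {v} {j} j∉ with adj G v j in vj
  ... | false = refl
  ... | true  = ⊥-elim (j∉ (lookup⇒∈ (trans (lookup∘tabulate (adj G v) j) vj)))

  ∉-neighbours-self : ∀ v → v ∉ neighbours v
  ∉-neighbours-self v v∈ with () ← trans (sym (∈-neighbours⁻ v∈)) (irrefl G v)

  clique-⁅⁆ : ∀ v → Clique G ⁅ v ⁆
  clique-⁅⁆ v i∈ j∈ i≢j = ⊥-elim $ i≢j (trans (x∈⁅y⁆⇒x≡y v i∈) (sym (x∈⁅y⁆⇒x≡y v j∈)))

  independent-⁅⁆ : ∀ v → Independent G ⁅ v ⁆
  independent-⁅⁆ v i∈ j∈ rewrite x∈⁅y⁆⇒x≡y v i∈ | x∈⁅y⁆⇒x≡y v j∈ = irrefl G v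

  clique-insert : ∀ {v Y} → Clique G Y → (∀ {j} → j ∈ Y → adj G v j ≡ true) →
                  Clique G (⁅ v ⁆ ∪ Y)
  clique-insert {v} {Y} clq v~Y {i} {j} i∈ j∈ i≢j with x∈p∪q⁻ ⁅ v ⁆ Y i∈ | x∈p∪q⁻ ⁅ v ⁆ Y j∈
  ... | inj₁ i∈v | inj₁ j∈v = clique-⁅⁆ v i∈v j∈v i≢j
  ... | inj₁ i∈v | inj₂ j∈Y rewrite x∈⁅y⁆⇒x≡y v i∈v = v~Y j∈Y
  ... | inj₂ i∈Y | inj₁ j∈v rewrite x∈⁅y⁆⇒x≡y v j∈v = trans (Graph.sym G i v) (v~Y i∈Y)
  ... | inj₂ i∈Y | inj₂ j∈Y = clq i∈Y j∈Y i≢j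

  independent-insert : ∀ {v Y} → Independent G Y → (∀ {j} → j ∈ Y → adj G v j ≡ false) →
                       Independent G (⁅ v ⁆ ∪ Y)
  independent-insert {v} {Y} ind v≁Y {i} {j} i∈ j∈ with x∈p∪q⁻ ⁅ v ⁆ Y i∈ | x∈p∪q⁻ ⁅ v ⁆ Y j∈
  ... | inj₁ i∈v | inj₁ j∈v = independent-⁅⁆ v i∈v j∈v
  ... | inj₁ i∈v | inj₂ j∈Y rewrite x∈⁅y⁆⇒x≡y v i∈v = v≁Y j∈Y
  ... | inj₂ i∈Y | inj₁ j∈v rewrite x∈⁅y⁆⇒x≡y v j∈v = trans (Graph.sym G i v) (v≁Y i∈Y)
  ... | inj₂ i∈Y | inj₂ j∈Y = ind i∈Y j∈Y

  nonNeighbours : Fin (n G) → Subset (n G)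
  nonNeighbours v = ∁ (⁅ v ⁆ ∪ neighbours v)

  ∈-nonNeighbours⁻ : ∀ {v j} → j ∈ nonNeighbours v → j ≢ v × adj G v j ≡ false
  ∈-nonNeighbours⁻ {v} j∈ = let j∉ = x∈∁p⇒x∉p j∈ in
    (λ { refl → j∉ (x∈p∪q⁺ (inj₁ (x∈⁅x⁆ v))) }) , ∉-neighbours⁻ (j∉ ∘ x∈p∪q⁺ ∘ inj₂)

  split-at : ∀ S v → S ⊆ ⁅ v ⁆ ∪ (S ∩ neighbours v ∪ S ∩ nonNeighbours v)
  split-at S v {x} x∈S with x ∈? (⁅ v ⁆ ∪ neighbours v)
  ... | no x∉ = x∈p∪q⁺ (inj₂ (x∈p∪q⁺ (inj₂ (x∈p∩q⁺ (x∈S , x∉p⇒x∈∁p x∉)))))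
  ... | yes x∈ with x∈p∪q⁻ ⁅ v ⁆ (neighbours v) x∈
  ...   | inj₁ x∈v = x∈p∪q⁺ (inj₁ x∈v)
  ...   | inj₂ x∈N = x∈p∪q⁺ (inj₂ (x∈p∪q⁺ (inj₁ (x∈p∩q⁺ (x∈S , x∈N)))))

  ∣∣-split-at : ∀ S v → ∣ S ∣ ≤ suc (∣ S ∩ neighbours v ∣ + ∣ S ∩ nonNeighbours v ∣)
  ∣∣-split-at S v = begin
    ∣ S ∣                        ≤⟨ p⊆q⇒∣p∣≤∣q∣ (split-at S v) ⟩
    ∣ ⁅ v ⁆ ∪ (N ∪ M) ∣          ≤⟨ ∣p∪q∣≤∣p∣+∣q∣ ⁅ v ⁆ (N ∪ M) ⟩
    ∣ ⁅ v ⁆ ∣ + ∣ N ∪ M ∣        ≤⟨ +-mono-≤ (≤-reflexive (∣⁅x⁆∣≡1 v)) (∣p∪q∣≤∣p∣+∣q∣ N M) ⟩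
    suc (∣ N ∣ + ∣ M ∣)          ∎
    where
    open ≤-Reasoning
    N = S ∩ neighbours v
    M = S ∩ nonNeighbours v

  cliquesAtMost-neighbours : ∀ {a S v} → v ∈ S → CliquesAtMost (suc a) S →
                             CliquesAtMost a (S ∩ neighbours v)
  cliquesAtMost-neighbours {a} {S} {v} v∈S atMost {Y} Y⊆N clq = ≤-pred $ begin
    suc ∣ Y ∣         ≡⟨ sym (∣⁅x⁆∪p∣≡1+∣p∣ v Y (∉-neighbours-self v ∘ proj₂ ∘ x∈p∩q⁻ S _ ∘ Y⊆N)) ⟩
    ∣ ⁅ v ⁆ ∪ Y ∣     ≤⟨ atMost (⁅x⁆∪p⊆q v∈S (p∩q⊆p S _ ∘ Y⊆N))
                                (clique-insert clq (∈-neighbours⁻ ∘ proj₂ ∘ x∈p∩q⁻ S _ ∘ Y⊆N)) ⟩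
    suc a             ∎
    where open ≤-Reasoning

  independentsAtMost-nonNeighbours : ∀ {b S v} → v ∈ S → IndependentsAtMost (suc b) S →
                                     IndependentsAtMost b (S ∩ nonNeighbours v)
  independentsAtMost-nonNeighbours {b} {S} {v} v∈S atMost {Y} Y⊆M ind = ≤-pred $ begin
    suc ∣ Y ∣         ≡⟨ sym (∣⁅x⁆∪p∣≡1+∣p∣ v Y λ v∈Y → proj₁ (nonNeighbour (Y⊆M v∈Y)) refl) ⟩
    ∣ ⁅ v ⁆ ∪ Y ∣     ≤⟨ atMost (⁅x⁆∪p⊆q v∈S (p∩q⊆p S _ ∘ Y⊆M))
                                (independent-insert ind (proj₂ ∘ nonNeighbour ∘ Y⊆M)) ⟩
    suc b             ∎
    where
    open ≤-Reasoning
    nonNeighbour : ∀ {j} → j ∈ S ∩ nonNeighbours v → j ≢ v × adj G v j ≡ false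
    nonNeighbour = ∈-nonNeighbours⁻ ∘ proj₂ ∘ x∈p∩q⁻ S _

  ramsey : ∀ a b S → CliquesAtMost a S → IndependentsAtMost b S → suc ∣ S ∣ ≤ 2 ^ (a + b)
  ramsey a b S _ _ with nonempty? S
  ramsey a b S _ _ | no empty rewrite Empty-unique empty | ∣⊥∣≡0 (n G) = m^n>0 2 (a + b)
  ramsey zero b S cl _ | yes (v , v∈S)
    with () ← subst (_≤ 0) (∣⁅x⁆∣≡1 v) (cl (⁅x⁆∪p⊆q v∈S ⊥⊆ ∘ x∈p∪q⁺ ∘ inj₁) (clique-⁅⁆ v))
  ramsey (suc a) zero S _ ind | yes (v , v∈S)
    with () ← subst (_≤ 0) (∣⁅x⁆∣≡1 v) (ind (⁅x⁆∪p⊆q v∈S ⊥⊆ ∘ x∈p∪q⁺ ∘ inj₁) (independent-⁅⁆ v))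
  ramsey (suc a) (suc b) S cl ind | yes (v , v∈S) = begin
    suc ∣ S ∣                            ≤⟨ s≤s (∣∣-split-at S v) ⟩
    suc (suc (∣ N ∣ + ∣ M ∣))            ≡⟨ cong suc (sym (+-suc ∣ N ∣ ∣ M ∣)) ⟩
    suc ∣ N ∣ + suc ∣ M ∣                ≤⟨ +-mono-≤ N-bound M-bound ⟩
    2 ^ (a + suc b) + 2 ^ (suc a + b)    ≡⟨ 2^-step a b ⟩
    2 ^ (suc a + suc b)                  ∎
    where
    open ≤-Reasoning
    N = S ∩ neighbours v
    M = S ∩ nonNeighbours v
    N-bound : suc ∣ N ∣ ≤ 2 ^ (a + suc b)
    N-bound = ramsey a (suc b) N (cliquesAtMost-neighbours v∈S cl)
                                 (λ Y⊆N → ind (p∩q⊆p S _ ∘ Y⊆N))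
    M-bound : suc ∣ M ∣ ≤ 2 ^ (suc a + b)
    M-bound = ramsey (suc a) b M (λ Y⊆M → cl (p∩q⊆p S _ ∘ Y⊆M))
                                 (independentsAtMost-nonNeighbours v∈S ind)

  n<2^[ω+α] : n G < 2 ^ (ω G + α G)
  n<2^[ω+α] = subst (λ m → suc m ≤ 2 ^ (ω G + α G)) (∣⊤∣≡n (n G))
    (ramsey (ω G) (α G) ⊤ (λ _ → clique⇒≤ω G) (λ _ ind → independent⇒≤αOn G ind ⊆⊤))

module _ (𝒢 : GraphClass) where

  Bounded-mono : ∀ {σ τ} → (∀ G → σ G ≤ τ G) → Bounded 𝒢 τ → Bounded 𝒢 σ
  Bounded-mono σ≤τ (c , bound) = c , λ G G∈ G' G'≤G → ≤-trans (σ≤τ G') (bound G G∈ G' G'≤G)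

  CliqueBounded-mono : ∀ {σ τ} → (∀ G → σ G ≤ τ G) → CliqueBounded 𝒢 τ → CliqueBounded 𝒢 σ
  CliqueBounded-mono σ≤τ (f , mono , bound) =
    f , mono , λ G G∈ G' G'≤G → ≤-trans (σ≤τ G') (bound G G∈ G' G'≤G)

  cliqueBounded-α⇒bounded-α : CliqueBounded 𝒢 α → Bounded 𝒢 α
  cliqueBounded-α⇒bounded-α (f , mono , bound) =
    f 1 , λ G G∈ G' G'≤G → α≤f[1] mono G' λ H H≤G' → bound G G∈ H (≤ᵢ-trans H≤G' G'≤G)

  bounded-α⇒cliqueBounded-n : Bounded 𝒢 α → CliqueBounded 𝒢 n
  bounded-α⇒cliqueBounded-n (c , bound) =
    (λ w → 2 ^ (w + c)) , (λ w≤w′ → ^-monoʳ-≤ 2 (+-monoˡ-≤ c w≤w′)) ,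
    λ G G∈ G' G'≤G → ≤-trans (<⇒≤ (n<2^[ω+α] G'))
                             (^-monoʳ-≤ 2 (+-monoʳ-≤ (ω G') (bound G G∈ G' G'≤G)))

  cliqueBounded-n⇔bounded-α : CliqueBounded 𝒢 n ⇔ Bounded 𝒢 α
  cliqueBounded-n⇔bounded-α =
    mk⇔ (cliqueBounded-α⇒bounded-α ∘ CliqueBounded-mono α≤n) bounded-α⇒cliqueBounded-n

  cliqueBounded-α⇔bounded-α : CliqueBounded 𝒢 α ⇔ Bounded 𝒢 α
  cliqueBounded-α⇔bounded-α =
    mk⇔ cliqueBounded-α⇒bounded-α (CliqueBounded-mono α≤n ∘ bounded-α⇒cliqueBounded-n)

awesome-via : ∀ ρ σ → (∀ G → value ρ G ≡ σ G) → (∀ G → αvalue ρ G ≡ α G) →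
              (∀ 𝒢 → CliqueBounded 𝒢 σ ⇔ Bounded 𝒢 α) → Awesome ρ
awesome-via ρ σ value≡σ αvalue≡α σ-criterion 𝒢 = mk⇔
  (Bounded-mono 𝒢 (≤-reflexive ∘ αvalue≡α) ∘ to (σ-criterion 𝒢)
     ∘ CliqueBounded-mono 𝒢 (≤-reflexive ∘ sym ∘ value≡σ))
  (CliqueBounded-mono 𝒢 (≤-reflexive ∘ value≡σ) ∘ from (σ-criterion 𝒢)
     ∘ Bounded-mono 𝒢 (≤-reflexive ∘ sym ∘ αvalue≡α))

value-orderHP : ∀ o G → value (orderHP o) G ≡ n G
value-orderHP minmax G = ∣⊤∣≡n (n G)
value-orderHP maxmin G = ∣⊤∣≡n (n G)

αvalue-orderHP : ∀ o G → αvalue (orderHP o) G ≡ α G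
αvalue-orderHP minmax G = refl
αvalue-orderHP maxmin G = refl

∈-independentSets⁻ : ∀ G {X} → X List.∈ List⁺.toList (independentSets G) → Independent G X
∈-independentSets⁻ G (Any.here refl) = independent-⊥ G
∈-independentSets⁻ G (Any.there X∈) =
  isIndependent⇒independent G (proj₂ (∈-filter⁻ (λ Y → T? (isIndependent G Y)) {xs = allSubsets (n G)} X∈))

∈-independentSets⁺ : ∀ G {X} → Independent G X → X List.∈ List⁺.toList (independentSets G)
∈-independentSets⁺ G {X} ind =
  Any.there (∈-filter⁺ (λ Y → T? (isIndependent G Y)) (∈-allSubsets X) (independent⇒isIndependent G ind))

max-independentSets≡α : ∀ G (f : Subset (n G) → ℕ) →
  (∀ {X} → Independent G X → f X ≤ α G) → (∀ {Y} → Independent G Y → ∣ Y ∣ ≤ f Y) →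
  max⁺ (List⁺.map f (independentSets G)) ≡ α G
max-independentSets≡α G f f≤α ∣∣≤f with αOn-attained G ⊤
... | Y , ind , α≡∣Y∣ = trans (max⁺-map f (independentSets G)) (≤-antisym upper lower)
  where
  open ≤-Reasoning
  fs = map f (List⁺.toList (independentSets G))
  upper : maxL fs ≤ α G
  upper = maxL-least fs λ m → let X , X∈ , eq = ∈-map⁻ f m in
    subst (_≤ α G) (sym eq) (f≤α (∈-independentSets⁻ G X∈))
  lower : α G ≤ maxL fs
  lower = begin
    α G      ≡⟨ α≡∣Y∣ ⟩
    ∣ Y ∣    ≤⟨ ∣∣≤f ind ⟩
    f Y      ≤⟨ maxL-upper (∈-map⁺ f (∈-independentSets⁺ G ind)) ⟩
    maxL fs  ∎

value-independenceHP : ∀ G → value independenceHP G ≡ α G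
value-independenceHP G =
  max-independentSets≡α G ∣_∣ (λ ind → independent⇒≤αOn G ind ⊆⊤) (λ _ → ≤-refl)

αvalue-independenceHP : ∀ G → αvalue independenceHP G ≡ α G
αvalue-independenceHP G =
  max-independentSets≡α G (αOn G) (λ {X} _ → αOn≤α G X) (λ ind → independent⇒≤αOn G ind ⊆-refl)

orderHP-awesome : ∀ o → Awesome (orderHP o)
orderHP-awesome o = awesome-via (orderHP o) n (value-orderHP o) (αvalue-orderHP o) cliqueBounded-n⇔bounded-α

independenceHP-awesome : Awesome independenceHP
independenceHP-awesome =
  awesome-via independenceHP α value-independenceHP αvalue-independenceHP cliqueBounded-α⇔bounded-α

proposition5p1 : Awesome (orderHP minmax) × Awesome (orderHP maxmin) × Awesome independenceHP
proposition5p1 = orderHP-awesome minmax , orderHP-awesome maxmin , independenceHP-awesome
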